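{- Let $G=(\mathcal X,\Sigma,\mathcal P,S)$ be an initialized context-free grammar with $\mathcal P\subseteq\mathcal X\times(\mathcal X^2\cup\Sigma\cup\{\varepsilon\})$, let $k>0$, and let $(N^k_G,\mathbf m_\imath)$ be the initialized Petri net defined in the context, with set of places $S_G$. For every multiset $\mathbf m$ over $S_G$: $\mathbf m\oplus[\$^k]$ is reachable from $\mathbf m_\imath$ in $N^k_G$ if and only if $\mathbf m\in\mathsf{Parikh}(L^{(k)}(G))$.
   Context: Multisets over a finite set are maps into $\mathbb N$; $\oplus$ is pointwise sum, $\preceq$ pointwise order, $[x]$ the multiset with one copy of $x$, $[x^j]$ the multiset with $j$ copies. $\mathsf{Parikh}(w)$ is the multiset of letter counts of $w$ and $\mathsf{Parikh}(L)=\{\mathsf{Parikh}(w)\mid w\in L\}$. A Petri net $(S,T,I,O)$ fires an enabled $t$ (i.e. $I(t)\preceq\mathbf m$) from $\mathbf m$ to $\mathbf m'$ with $\mathbf m'\oplus I(t)=\mathbf m\oplus O(t)$; reachability means by a finite firing sequence. For a word $\alpha$, $\#_{\mathcal X}(\alpha)$ is the number of occurrences of nonterminals in $\alpha$. A derivation $S=\alpha_0\Rightarrow\cdots\Rightarrow\alpha_m$ has index $k$ if $\#_{\mathcal X}(\alpha_i)\le k$ for all $i$; $L^{(k)}(G)$ is the set of words in $\Sigma^*$ derivable from $S$ by derivations of index $k$. The net $N^k_G$ has places $S_G=\mathcal X\cup\Sigma\cup\{\$\}$, transitions $T_G=\mathcal P$, with $I(X\to ZY)=[X,\$]$, $O(X\to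 ZY)=[Z,Y]$, and for $\sigma\in\Sigma\cup\{\varepsilon\}$, $I(X\to\sigma)=[X]$, $O(X\to\sigma)=\mathsf{Parikh}(\sigma)\oplus[\$]$; its initial marking is $\mathbf m_\imath=[S]\oplus[\$^{k-1}]$. -}

module Defs where

open import Data.Nat using (ℕ; zero; suc; _+_; _*_; _∸_; _≤_)
open import Data.Fin using (Fin)
open import Data.Fin.Properties using () renaming (_≟_ to _≟F_)
open import Data.List using (List; []; _∷_; _++_; map)
open import Data.List.Membership.Propositional using (_∈_)
open import Data.Product using (Σ; _×_; _,_; ∃)
open import Relation.Nullary using (yes; no)
open import Relation.Binary.PropositionalEquality using (_≡_)

data Rhs (nX nΣ : ℕ) : Set where
  two  : Fin nX → Fin nX → Rhs nX nΣ
  term : Fin nΣ → Rhs nX nΣ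
  eps  : Rhs nX nΣ

Prod : ℕ → ℕ → Set
Prod nX nΣ = Fin nX × Rhs nX nΣ

record Grammar : Set where
  field
    nX : ℕ
    nΣ : ℕ
    P  : List (Prod nX nΣ)
    S  : Fin nX
open Grammar public

data Sym (G : Grammar) : Set where
  N : Fin (nX G) → Sym G
  T : Fin (nΣ G) → Sym G

rhsWord : {G : Grammar} → Rhs (nX G) (nΣ G) → List (Sym G)
rhsWord (two Z Y) = N Z ∷ N Y ∷ []
rhsWord (term a)  = T a ∷ []
rhsWord eps       = []

#X : {G : Grammar} → List (Sym G) → ℕ
#X []          = 0
#X (N _ ∷ α)   = suc (#X α)
#X (T _ ∷ α)   = #X α

Step : (G : Grammar) → List (Sym G) → List (Sym G) → Set
Step G α β = Σ (List (Sym G)) λ u → Σ (List (Sym G)) λ v →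
  Σ (Fin (nX G)) λ X → Σ (Rhs (nX G) (nΣ G)) λ r →
  ((X , r) ∈ P G) × (α ≡ u ++ N X ∷ v) × (β ≡ u ++ rhsWord r ++ v)

data DerivK (G : Grammar) (k : ℕ) : List (Sym G) → List (Sym G) → Set where
  stop : ∀ {α} → #X α ≤ k → DerivK G k α α
  next : ∀ {α β γ} → #X α ≤ k → Step G α β → DerivK G k β γ → DerivK G k α γ

InLk : (G : Grammar) → ℕ → List (Fin (nΣ G)) → Set
InLk G k w = DerivK G k (N (S G) ∷ []) (map T w)

data Place (G : Grammar) : Set where
  nt     : Fin (nX G) → Place G
  tm     : Fin (nΣ G) → Place G
  dollar : Place G

MSet : Grammar → Set
MSet G = Place G → ℕ

module _ {G : Grammar} where

  _⊕_ : MSet G → MSet G → MSet G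
  (m ⊕ m') p = m p + m' p

  _≼_ : MSet G → MSet G → Set
  m ≼ m' = ∀ p → m p ≤ m' p

  _≐_ : MSet G → MSet G → Set
  m ≐ m' = ∀ p → m p ≡ m' p

  ∅ : MSet G
  ∅ _ = 0

  ⟦_⟧ : Place G → MSet G
  ⟦ nt x ⟧ (nt y) with x ≟F y
  ... | yes _ = 1
  ... | no _  = 0
  ⟦ tm a ⟧ (tm b) with a ≟F b
  ... | yes _ = 1
  ... | no _  = 0
  ⟦ dollar ⟧ dollar = 1
  ⟦ _ ⟧ _ = 0

  copies : ℕ → Place G → MSet G
  copies j x p = j * ⟦ x ⟧ p

  parikh : List (Fin (nΣ G)) → MSet G
  parikh []      = ∅
  parikh (a ∷ w) = ⟦ tm a ⟧ ⊕ parikh w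

module _ {G : Grammar} where

  Iₜ : Prod (nX G) (nΣ G) → MSet G
  Iₜ (X , two _ _) = ⟦ nt X ⟧ ⊕ ⟦ dollar ⟧
  Iₜ (X , term _)  = ⟦ nt X ⟧
  Iₜ (X , eps)     = ⟦ nt X ⟧

  Oₜ : Prod (nX G) (nΣ G) → MSet G
  Oₜ (_ , two Z Y) = ⟦ nt Z ⟧ ⊕ ⟦ nt Y ⟧
  Oₜ (_ , term a)  = ⟦ tm a ⟧ ⊕ ⟦ dollar ⟧
  Oₜ (_ , eps)     = ∅ ⊕ ⟦ dollar ⟧

Fire : (G : Grammar) → MSet G → MSet G → Set
Fire G m m' = Σ (Prod (nX G) (nΣ G)) λ t →
  (t ∈ P G) × (Iₜ t ≼ m) × ((m' ⊕ Iₜ t) ≐ (m ⊕ Oₜ t))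

data Reach (G : Grammar) : MSet G → MSet G → Set where
  done : ∀ {m m'} → m ≐ m' → Reach G m m'
  fire : ∀ {m m' m''} → Fire G m m' → Reach G m' m'' → Reach G m m''

mInit : (G : Grammar) → ℕ → MSet G
mInit G k = ⟦ nt (S G) ⟧ ⊕ copies (k ∸ 1) dollar

InParikhLk : (G : Grammar) → ℕ → MSet G → Set
InParikhLk G k m = Σ (List (Fin (nΣ G))) λ w → InLk G k w × (m ≐ parikh w)

module Submission where

open import Defs
open import Data.Nat using (ℕ; _<_)
open import Function.Bundles using (_⇔_)

open import Data.Nat using (zero; suc; _+_; _*_; _∸_; _≤_)
open import Data.Nat.Properties
open import Data.Nat.Tactic.RingSolver using (solve-∀)
open import Data.Fin.Properties using () renaming (_≟_ to _≟F_)
open import Data.List using (List; []; _∷_; _++_; map)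
open import Data.List.Membership.Propositional using (_∈_)
open import Data.Product using (_×_; _,_; ∃-syntax)
open import Data.Empty using (⊥-elim)
open import Relation.Nullary using (yes; no)
open import Relation.Binary.PropositionalEquality
open import Function.Bundles using (mk⇔)

-- A sentential form α together with a number d of "free" dollar
-- tokens is represented by the marking  mark α d = Parikh(α) ⊕ [$^d].  The form
-- is *balanced* when #X(α) + d = k, i.e. nonterminals and dollars together
-- always number k; the initial marking is the balanced representation of the
-- form S.  Applying a rule X → r at an occurrence of X in α = u X v, and firing
-- the transition (X → r) from mark α d, both replace Parikh(X) ⊕ [$^in(r)] by
-- Parikh(r) ⊕ [$^out(r)] inside the common context  mark (u v) c,  where a binary
-- rule consumes one dollar and a terminal/ε rule produces one.  Hence
--   * every derivation step between balanced forms of index ≤ k is a firing;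
--   * every firing from a balanced representation is such a derivation step;
--   * a balanced marking of the shape m ⊕ [$^k] has no nonterminals, so it
--     represents a terminal word whose Parikh image is m.

private
  swap-last : ∀ a b c → a + b + c ≡ a + c + b
  swap-last = solve-∀

  plug-arith : ∀ pu pw pv a c D →
    pu + (pw + pv) + (a + c) * D ≡ pu + pv + c * D + (pw + a * D)
  plug-arith = solve-∀

  insert-arith : ∀ x y z → x + (y + z) ≡ x + z + y
  insert-arith = solve-∀

  shift-arith : ∀ n w a c → n + w + (a + c) ≡ n + (w + a) + c
  shift-arith = solve-∀

dollarsIn dollarsOut : ∀ {nX nΣ} → Rhs nX nΣ → ℕ
dollarsIn (two _ _) = 1
dollarsIn (term _)  = 0
dollarsIn eps       = 0
dollarsOut (two _ _) = 0
dollarsOut (term _)  = 1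
dollarsOut eps       = 1

module _ {G : Grammar} where

  ≐-sym : {m₁ m₂ : MSet G} → m₁ ≐ m₂ → m₂ ≐ m₁
  ≐-sym e p = sym (e p)

  ≐-trans : {m₁ m₂ m₃ : MSet G} → m₁ ≐ m₂ → m₂ ≐ m₃ → m₁ ≐ m₃
  ≐-trans e e' p = trans (e p) (e' p)

  ⊕-congˡ : {c m m' : MSet G} → m ≐ m' → (c ⊕ m) ≐ (c ⊕ m')
  ⊕-congˡ {c} e p = cong (c p +_) (e p)

  fire-resp : {m₁ m₂ m' : MSet G} → m₁ ≐ m₂ → Fire G m₂ m' → Fire G m₁ m'
  fire-resp e (t , t∈P , I≼m , eq) =
    t , t∈P , (λ p → subst (Iₜ t p ≤_) (sym (e p)) (I≼m p))
            , (λ p → trans (eq p) (cong (_+ Oₜ t p) (sym (e p))))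

  reach-resp : {m₁ m₂ m₃ m₄ : MSet G} →
               m₁ ≐ m₂ → Reach G m₂ m₃ → m₃ ≐ m₄ → Reach G m₁ m₄
  reach-resp e (done e')   e'' = done (≐-trans e (≐-trans e' e''))
  reach-resp e (fire f R)  e'' = fire (fire-resp e f) (reach-resp (λ _ → refl) R e'')

  fire-in-context : ∀ {m m' c : MSet G} t → t ∈ P G →
                    m ≐ (c ⊕ Iₜ t) → m' ≐ (c ⊕ Oₜ t) → Fire G m m'
  fire-in-context {m} {m'} {c} t t∈P em em' =
    t , t∈P , (λ p → subst (Iₜ t p ≤_) (sym (em p)) (m≤n+m (Iₜ t p) (c p))) , balance
    where
    balance : (m' ⊕ Iₜ t) ≐ (m ⊕ Oₜ t)
    balance p = begin
      m' p + Iₜ t p          ≡⟨ cong (_+ Iₜ t p) (em' p) ⟩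
      c p + Oₜ t p + Iₜ t p  ≡⟨ swap-last (c p) (Oₜ t p) (Iₜ t p) ⟩
      c p + Iₜ t p + Oₜ t p  ≡⟨ cong (_+ Oₜ t p) (sym (em p)) ⟩
      m p + Oₜ t p           ∎
      where open ≡-Reasoning

  fire-determined : ∀ {m m' c : MSet G} t →
                    (m' ⊕ Iₜ t) ≐ (m ⊕ Oₜ t) → m ≐ (c ⊕ Iₜ t) → m' ≐ (c ⊕ Oₜ t)
  fire-determined {m} {m'} {c} t eq em p = +-cancelʳ-≡ (Iₜ t p) (m' p) (c p + Oₜ t p) (begin
    m' p + Iₜ t p          ≡⟨ eq p ⟩
    m p + Oₜ t p           ≡⟨ cong (_+ Oₜ t p) (em p) ⟩
    c p + Iₜ t p + Oₜ t p  ≡⟨ swap-last (c p) (Iₜ t p) (Oₜ t p) ⟩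
    c p + Oₜ t p + Iₜ t p  ∎)
    where open ≡-Reasoning

  occ : List (Sym G) → MSet G
  occ []        = ∅
  occ (N X ∷ α) = ⟦ nt X ⟧ ⊕ occ α
  occ (T a ∷ α) = ⟦ tm a ⟧ ⊕ occ α

  occ-++ : ∀ u w → occ (u ++ w) ≐ (occ u ⊕ occ w)
  occ-++ []        w p = refl
  occ-++ (N X ∷ u) w p = trans (cong (⟦ nt X ⟧ p +_) (occ-++ u w p)) (sym (+-assoc (⟦ nt X ⟧ p) _ _))
  occ-++ (T a ∷ u) w p = trans (cong (⟦ tm a ⟧ p +_) (occ-++ u w p)) (sym (+-assoc (⟦ tm a ⟧ p) _ _))

  occ-dollar : ∀ α → occ α dollar ≡ 0
  occ-dollar []        = refl
  occ-dollar (N _ ∷ α) = occ-dollar α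
  occ-dollar (T _ ∷ α) = occ-dollar α

  occ-terminal : ∀ w → occ (map T w) ≐ parikh w
  occ-terminal []      p = refl
  occ-terminal (a ∷ w) p = cong (⟦ tm a ⟧ p +_) (occ-terminal w p)

  #X-++ : ∀ (u w : List (Sym G)) → #X (u ++ w) ≡ #X u + #X w
  #X-++ []        w = refl
  #X-++ (N _ ∷ u) w = cong suc (#X-++ u w)
  #X-++ (T _ ∷ u) w = #X-++ u w

  #X-insert : ∀ (u w v : List (Sym G)) → #X (u ++ w ++ v) ≡ #X (u ++ v) + #X w
  #X-insert u w v rewrite #X-++ u (w ++ v) | #X-++ w v | #X-++ u v =
    insert-arith (#X u) (#X w) (#X v)

  #X-terminal : ∀ w → #X {G} (map T w) ≡ 0
  #X-terminal []      = refl
  #X-terminal (_ ∷ w) = #X-terminal w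

  terminal-form : ∀ (α : List (Sym G)) → #X α ≡ 0 → ∃[ w ] α ≡ map T w
  terminal-form []        _ = [] , refl
  terminal-form (T a ∷ α) e with terminal-form α e
  ... | w , refl = a ∷ w , refl

  ⟦nt⟧-self : ∀ X → ⟦_⟧ {G} (nt X) (nt X) ≡ 1
  ⟦nt⟧-self X with X ≟F X
  ... | yes _ = refl
  ... | no X≢X = ⊥-elim (X≢X refl)

  occurrence : ∀ (α : List (Sym G)) X → 1 ≤ occ α (nt X) →
               ∃[ u ] ∃[ v ] α ≡ u ++ N X ∷ v
  occurrence (N Y ∷ α) X h with Y ≟F X
  ... | yes refl = [] , α , refl
  ... | no _ with occurrence α X h
  ...   | u , v , refl = N Y ∷ u , v , refl
  occurrence (T a ∷ α) X h with occurrence α X h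
  ... | u , v , refl = T a ∷ u , v , refl

  mark : List (Sym G) → ℕ → MSet G
  mark α d = occ α ⊕ copies d dollar

  mark-dollar : ∀ α d → mark α d dollar ≡ d
  mark-dollar α d = cong₂ _+_ (occ-dollar α) (*-identityʳ d)

  mark-plug : ∀ u w v a c →
              mark (u ++ w ++ v) (a + c) ≐ (mark (u ++ v) c ⊕ (occ w ⊕ copies a dollar))
  mark-plug u w v a c p
    rewrite occ-++ u (w ++ v) p | occ-++ w v p | occ-++ u v p =
    plug-arith (occ u p) (occ w p) (occ v p) a c (⟦ dollar ⟧ p)

  input-shape : ∀ X r → Iₜ (X , r) ≐ (occ (N X ∷ []) ⊕ copies (dollarsIn r) dollar)
  input-shape X (two _ _) p = sym (cong₂ _+_ (+-identityʳ (⟦ nt X ⟧ p)) (+-identityʳ (⟦ dollar ⟧ p)))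
  input-shape X (term _)  p = sym (trans (+-identityʳ _) (+-identityʳ _))
  input-shape X eps       p = sym (trans (+-identityʳ _) (+-identityʳ _))

  output-shape : ∀ X r → Oₜ (X , r) ≐ (occ (rhsWord r) ⊕ copies (dollarsOut r) dollar)
  output-shape X (two Z Y) p = sym (trans (+-identityʳ _) (cong (⟦ nt Z ⟧ p +_) (+-identityʳ _)))
  output-shape X (term a)  p = sym (cong₂ _+_ (+-identityʳ (⟦ tm a ⟧ p)) (+-identityʳ (⟦ dollar ⟧ p)))
  output-shape X eps       p = sym (+-identityʳ _)

  tokens-conserved : ∀ X r → #X {G} (N X ∷ []) + dollarsIn r ≡ #X (rhsWord {G} r) + dollarsOut r
  tokens-conserved X (two _ _) = refl
  tokens-conserved X (term _)  = refl
  tokens-conserved X eps       = refl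

  before-step : ∀ u v X r c →
                mark (u ++ N X ∷ v) (dollarsIn r + c) ≐ (mark (u ++ v) c ⊕ Iₜ (X , r))
  before-step u v X r c =
    ≐-trans (mark-plug u (N X ∷ []) v (dollarsIn r) c) (⊕-congˡ (≐-sym (input-shape X r)))

  after-step : ∀ u v X r c →
               mark (u ++ rhsWord r ++ v) (dollarsOut r + c) ≐ (mark (u ++ v) c ⊕ Oₜ (X , r))
  after-step u v X r c =
    ≐-trans (mark-plug u (rhsWord r) v (dollarsOut r) c) (⊕-congˡ (≐-sym (output-shape X r)))

  step-fires : ∀ {u v X r c} → (X , r) ∈ P G →
               Fire G (mark (u ++ N X ∷ v) (dollarsIn r + c))
                      (mark (u ++ rhsWord r ++ v) (dollarsOut r + c))
  step-fires {u} {v} {X} {r} {c} mem =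
    fire-in-context (X , r) mem (before-step u v X r c) (after-step u v X r c)

  data Successor : List (Sym G) → ℕ → MSet G → Set where
    rewrite-at : ∀ {u v X r c m'} → (X , r) ∈ P G →
                 m' ≐ mark (u ++ rhsWord r ++ v) (dollarsOut r + c) →
                 Successor (u ++ N X ∷ v) (dollarsIn r + c) m'

  input-nt : ∀ X r → 1 ≤ Iₜ {G} (X , r) (nt X)
  input-nt X (two _ _) = subst (λ n → 1 ≤ n + 0) (sym (⟦nt⟧-self X)) ≤-refl
  input-nt X (term _)  = ≤-reflexive (sym (⟦nt⟧-self X))
  input-nt X eps       = ≤-reflexive (sym (⟦nt⟧-self X))

  input-dollar : ∀ X r → Iₜ {G} (X , r) dollar ≡ dollarsIn r
  input-dollar X (two _ _) = refl
  input-dollar X (term _)  = refl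
  input-dollar X eps       = refl

  firing-is-step : ∀ {m m' : MSet G} α d → Fire G m m' → m ≐ mark α d → Successor α d m'
  firing-is-step {m} α d ((X , r) , mem , I≼m , eq) em
    with occurrence α X (≤-trans (input-nt X r) (≤-trans (I≼m (nt X)) (≤-reflexive at-X)))
       | m≤n⇒∃[o]m+o≡n (subst₂ _≤_ (input-dollar X r) (trans (em dollar) (mark-dollar α d)) (I≼m dollar))
    where
    at-X : m (nt X) ≡ occ α (nt X)
    at-X = trans (em (nt X)) (trans (cong (occ α (nt X) +_) (*-zeroʳ d)) (+-identityʳ _))
  ... | u , v , refl | c , refl =
    rewrite-at mem (≐-trans (fire-determined (X , r) eq (≐-trans em (before-step u v X r c)))
                            (≐-sym (after-step u v X r c)))

module Index (G : Grammar) (k : ℕ) where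

  Balanced : List (Sym G) → ℕ → Set
  Balanced α d = #X α + d ≡ k

  balanced-index : ∀ α d → Balanced α d → #X α ≤ k
  balanced-index α d b = subst (#X α ≤_) b (m≤m+n (#X α) d)

  #X-shift : ∀ u v w a c → #X {G} (u ++ w ++ v) + (a + c) ≡ #X (u ++ v) + (#X w + a) + c
  #X-shift u v w a c =
    trans (cong (_+ (a + c)) (#X-insert u w v)) (shift-arith (#X (u ++ v)) (#X w) a c)

  balance-step : ∀ u v X r c →
                 Balanced (u ++ N X ∷ v) (dollarsIn r + c) →
                 Balanced (u ++ rhsWord r ++ v) (dollarsOut r + c)
  balance-step u v X r c b = begin
    #X (u ++ rhsWord r ++ v) + (dollarsOut r + c)   ≡⟨ #X-shift u v (rhsWord r) (dollarsOut r) c ⟩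
    #X (u ++ v) + (#X (rhsWord r) + dollarsOut r) + c
      ≡⟨ cong (λ n → #X (u ++ v) + n + c) (sym (tokens-conserved X r)) ⟩
    #X (u ++ v) + (#X {G} (N X ∷ []) + dollarsIn r) + c
      ≡⟨ sym (#X-shift u v (N X ∷ []) (dollarsIn r) c) ⟩
    #X (u ++ N X ∷ v) + (dollarsIn r + c)           ≡⟨ b ⟩
    k                                               ∎
    where open ≡-Reasoning

  -- If the result of rewriting has index ≤ k, the dollar a binary rule needs is there.
  dollar-available : ∀ u v X r d → Balanced (u ++ N X ∷ v) d →
                     #X (u ++ rhsWord r ++ v) ≤ k → ∃[ c ] d ≡ dollarsIn r + c
  dollar-available u v X (two Z Y) zero b h =
    ⊥-elim (1+n≰n (+-cancelˡ-≤ (#X (u ++ v)) 2 1 too-many))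
    where
    too-many : #X (u ++ v) + 2 ≤ #X (u ++ v) + 1
    too-many = subst₂ _≤_ (#X-insert u (N Z ∷ N Y ∷ []) v)
                          (trans (sym b) (trans (+-identityʳ _) (#X-insert u (N X ∷ []) v))) h
  dollar-available u v X (two _ _) (suc c) b h = c , refl
  dollar-available u v X (term _)  d       b h = d , refl
  dollar-available u v X eps       d       b h = d , refl

  head-index : ∀ {α γ} → DerivK G k α γ → #X α ≤ k
  head-index (stop h)     = h
  head-index (next h _ _) = h

  no-surplus : ∀ α x → Balanced α (x + k) → #X α ≡ 0 × x ≡ 0
  no-surplus α x b = m+n≡0⇒m≡0 (#X α) none , m+n≡0⇒n≡0 (#X α) none
    where
    none : #X α + x ≡ 0
    none = +-cancelʳ-≡ k (#X α + x) 0 (trans (+-assoc (#X α) x k) b)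

  off-dollar : ∀ {m₀ : MSet G} α d p → (∀ n → copies n dollar p ≡ 0) →
               mark α d ≐ (m₀ ⊕ copies k dollar) → occ α p ≡ m₀ p
  off-dollar {m₀} α d p no-$ e = begin
    occ α p                       ≡⟨ sym (+-identityʳ _) ⟩
    occ α p + 0                   ≡⟨ cong (occ α p +_) (sym (no-$ d)) ⟩
    mark α d p                    ≡⟨ e p ⟩
    m₀ p + copies k dollar p      ≡⟨ cong (m₀ p +_) (no-$ k) ⟩
    m₀ p + 0                      ≡⟨ +-identityʳ _ ⟩
    m₀ p                          ∎
    where open ≡-Reasoning

  terminal-marking : ∀ {m₀ : MSet G} α d → Balanced α d → mark α d ≐ (m₀ ⊕ copies k dollar) →
                     ∃[ w ] α ≡ map T w × m₀ ≐ parikh w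
  terminal-marking {m₀} α d b e with no-surplus α (m₀ dollar) (subst (Balanced α) d≡ b)
    where
    d≡ : d ≡ m₀ dollar + k
    d≡ = trans (sym (mark-dollar α d)) (trans (e dollar) (cong (m₀ dollar +_) (*-identityʳ k)))
  ... | no-nt , no-$ with terminal-form α no-nt
  ...   | w , refl = w , refl , same
    where
    same : m₀ ≐ parikh w
    same dollar = trans no-$ (sym (trans (sym (occ-terminal w dollar)) (occ-dollar (map T w))))
    same (nt x) = trans (sym (off-dollar (map T w) d (nt x) *-zeroʳ e)) (occ-terminal w (nt x))
    same (tm a) = trans (sym (off-dollar (map T w) d (tm a) *-zeroʳ e)) (occ-terminal w (tm a))

  derivation-reaches : ∀ {α γ d e} → DerivK G k α γ → Balanced α d → Balanced γ e →
                       Reach G (mark α d) (mark γ e)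
  derivation-reaches {α} (stop _) b b' =
    done (λ p → cong (λ n → occ α p + n * ⟦_⟧ {G} dollar p) (+-cancelˡ-≡ (#X α) _ _ (trans b (sym b'))))
  derivation-reaches {d = d} (next _ (u , v , X , r , mem , refl , refl) D) b b'
    with dollar-available u v X r d b (head-index D)
  ... | c , refl = fire (step-fires {u = u} {v} mem) (derivation-reaches D (balance-step u v X r c b) b')

  reach-derives : ∀ {m m'' m₀ : MSet G} α d → Reach G m m'' → m ≐ mark α d → Balanced α d →
                  m'' ≐ (m₀ ⊕ copies k dollar) →
                  ∃[ w ] DerivK G k α (map T w) × m₀ ≐ parikh w
  reach-derives α d (done e') e b e'' with terminal-marking α d b (≐-trans (≐-sym e) (≐-trans e' e''))
  ... | w , refl , same = w , stop (balanced-index α d b) , same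
  reach-derives α d (fire f R) e b e'' with firing-is-step α d f e
  ... | rewrite-at {u} {v} {X} {r} {c} mem e' with reach-derives _ _ R e' (balance-step u v X r c b) e''
  ...   | w , D , same = w , next (balanced-index α d b) (u , v , X , r , mem , refl , refl) D , same

lemma5p5 : (G : Grammar) (k : ℕ) → 0 < k → (m : MSet G) →
    Reach G (mInit G k) (m ⊕ copies k dollar) ⇔ InParikhLk G k m
lemma5p5 G k k>0 m = mk⇔ sound complete
  where
  open Index G k

  initial : mInit G k ≐ mark (N (S G) ∷ []) (k ∸ 1)
  initial p = cong (_+ copies (k ∸ 1) dollar p) (sym (+-identityʳ _))

  initial-balanced : Balanced (N (S G) ∷ []) (k ∸ 1)
  initial-balanced = m+[n∸m]≡n k>0

  sound : Reach G (mInit G k) (m ⊕ copies k dollar) → InParikhLk G k m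
  sound R = reach-derives _ _ R initial initial-balanced (λ _ → refl)

  complete : InParikhLk G k m → Reach G (mInit G k) (m ⊕ copies k dollar)
  complete (w , D , same) =
    reach-resp initial (derivation-reaches D initial-balanced (cong (_+ k) (#X-terminal w))) final
    where
    final : mark (map T w) k ≐ (m ⊕ copies k dollar)
    final p = cong (_+ copies k dollar p) (trans (occ-terminal w p) (sym (same p)))
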